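{- Let $G$ be a graph on $n$ vertices with average degree $t$, where $2 \le t \le \frac{n}{800}$. Then the number $i(G)$ of independent sets in $G$ satisfies \[ i(G) \geq 2^{\frac{1}{250}\frac{n}{t}\log t}. \]
   Context: All logarithms are base $2$. For a graph $G$, $i(G)$ denotes the number of independent sets in $G$ (subsets $I\subseteq V(G)$ with no two vertices of $I$ adjacent). The average degree of a graph on $n$ vertices with $e$ edges is $2e/n$. -}

module Defs where

open import Data.Bool using (Bool; true; false; _∧_; not)
open import Data.Nat using (ℕ; zero; suc; _<ᵇ_)
open import Data.Fin using (Fin; toℕ)
open import Data.Fin.Subset using (Subset; inside; outside)
open import Data.List using (List; []; _∷_; _++_; map; length; filterᵇ; concatMap; allFin)
open import Data.Vec using (Vec; []; _∷_; lookup)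
open import Data.Product using (_×_; _,_)
open import Data.Bool.ListAction using (and)
open import Relation.Binary.PropositionalEquality using (_≡_)

record Graph (n : ℕ) : Set where
  field
    adj    : Fin n → Fin n → Bool
    sym    : ∀ i j → adj i j ≡ adj j i
    irrefl : ∀ i → adj i i ≡ false
open Graph public

pairs : (n : ℕ) → List (Fin n × Fin n)
pairs n = concatMap (λ i → map (λ j → (i , j)) (allFin n)) (allFin n)

edges : ∀ {n} → Graph n → ℕ
edges {n} G = length (filterᵇ (λ { (i , j) → (toℕ i <ᵇ toℕ j) ∧ adj G i j }) (pairs n))

allSubsets : (n : ℕ) → List (Subset n)
allSubsets zero    = [] ∷ []
allSubsets (suc n) = map (outside ∷_) (allSubsets n) ++ map (inside ∷_) (allSubsets n)

independentᵇ : ∀ {n} → Graph n → Subset n → Bool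
independentᵇ {n} G S =
  and (map (λ { (i , j) → not (lookup S i ∧ lookup S j ∧ adj G i j) }) (pairs n))

numIndep : ∀ {n} → Graph n → ℕ
numIndep {n} G = length (filterᵇ (independentᵇ G) (allSubsets n))

{-# OPTIONS --safe #-}
module Submission where

-- Write D = 2e and p = ⌊D/n⌋, so that D < (p + 1)n, and let Δ = 2p + 1. By Markov's
-- inequality at least half of the vertices have degree at most Δ. If every vertex of a
-- vertex set U has degree at most Δ and a + kΔ ≤ |U|, then U contains at least C(a, k)
-- independent sets: for v ∈ U, those avoiding v are independent sets of U − v, those
-- containing v arise from independent sets of U − N[v], and Pascal's rule adds the two
-- inductive bounds. With k = ⌊n / 6(p + 1)⌋ and a = k(p + 1) this gives
-- i(G) ≥ C(k(p + 1), k) ≥ (p + 1)^k. Finally n ≤ 24pk, so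
-- D^(n²) ≤ (p + 1)^(n²) n^(n²) ≤ (p + 1)^(250kD) n^(n²) ≤ i(G)^(250D) n^(n²);
-- this arithmetic needs only n ≤ D and 12D ≤ n².

open import Data.Bool using (Bool; true; false; T; not; _∧_; _∨_)
open import Data.Bool.ListAction using (all)
open import Data.Bool.Properties using (T-∧; T-∨)
open import Data.Empty using (⊥-elim)
open import Data.Fin using (Fin; zero; suc; _≟_; toℕ)
open import Data.Fin.Properties using (toℕ-injective)
open import Data.Fin.Subset using (Subset; inside; outside)
open import Data.List using (List; []; _∷_; _++_; map; length; filterᵇ; allFin; tabulate; concat)
open import Data.List.Membership.Propositional using (_∈_)
open import Data.List.Membership.Propositional.Properties using (∈-allFin; ∈-map⁺; ∈-concat⁺′)
open import Data.List.Properties using (length-++; filter-++; map-tabulate)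
import Data.List.Relation.Unary.All as All
open import Data.List.Relation.Unary.All.Properties using (all⁺; all⁻)
open import Data.Nat using (ℕ; zero; suc; _+_; _*_; _^_; _≤_; _<_; _<ᵇ_; _≤ᵇ_; z≤n; s≤s; NonZero)
open import Data.Nat.Combinatorics using (_C_; nCk+nC[k+1]≡[n+1]C[k+1])
open import Data.Nat.DivMod using (_/_; _%_; m/n*n≤m; m%n<n; m≡m%n+[m/n]*n; m≥n⇒m/n>0)
open import Data.Nat.Properties hiding (_≟_)
open import Data.Nat.Tactic.RingSolver using (solve-∀)
open import Data.Product using (∃; _×_; _,_; proj₁; proj₂)
open import Data.Sum using (inj₁; inj₂)
open import Data.Vec using ([]; _∷_; lookup; replicate; _[_]≔_)
open import Data.Vec.Properties using (lookup∘update; lookup∘update′; lookup-replicate)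
open import Defs using (Graph; adj; edges; numIndep; independentᵇ; allSubsets; pairs)
open import Function using (_∘_; id)
open import Function.Bundles using (Equivalence; _⇔_; mk⇔)
open import Relation.Binary.PropositionalEquality
open import Relation.Nullary using (¬_; T?; ⌊_⌋; yes; no; fromWitness)

open import Algebra.Properties.CommutativeSemigroup +-commutativeSemigroup
  using () renaming (interchange to +-interchange)
open import Algebra.Properties.CommutativeSemigroup *-commutativeSemigroup
  using () renaming (interchange to *-interchange)
open import Algebra.Properties.Semiring.Sum +-*-semiring
  using (sum; sum-syntax; sum-cong-≗; ∑-distrib-+; ∑-comm; *-distribˡ-sum)
open Equivalence using (to; from)

iverson : Bool → ℕ
iverson true  = 1
iverson false = 0

iverson-mono : ∀ {a b} → (T a → T b) → iverson a ≤ iverson b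
iverson-mono {false}         _   = z≤n
iverson-mono {true}  {true}  _   = ≤-refl
iverson-mono {true}  {false} a⇒b = ⊥-elim (a⇒b _)

iverson-∧ : ∀ a b → iverson (a ∧ b) ≡ iverson a * iverson b
iverson-∧ false _ = refl
iverson-∧ true  b = sym (+-identityʳ (iverson b))

iverson-∨ : ∀ a b → iverson (a ∨ b) ≤ iverson a + iverson b
iverson-∨ true  _ = s≤s z≤n
iverson-∨ false _ = ≤-refl

iverson-split : ∀ a b → iverson a ≡ iverson (a ∧ b) + iverson (a ∧ not b)
iverson-split false _     = refl
iverson-split true  true  = refl
iverson-split true  false = refl

T-not : ∀ b → T (not b) ⇔ (¬ T b)
T-not true  = mk⇔ (λ ()) (λ ¬t → ¬t _)
T-not false = mk⇔ (λ _ ()) _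

T-not-∨ : ∀ a b → T (not a ∨ b) ⇔ (T a → T b)
T-not-∨ true  b = mk⇔ (λ b _ → b) (λ a⇒b → a⇒b _)
T-not-∨ false b = mk⇔ (λ _ ()) _

T-not-∧∧ : ∀ a b c → T (not (a ∧ b ∧ c)) ⇔ (T a → T b → ¬ T c)
T-not-∧∧ true  true  true  = mk⇔ (λ ()) (λ h → h _ _ _)
T-not-∧∧ true  true  false = mk⇔ (λ _ _ _ ()) _
T-not-∧∧ true  false c     = mk⇔ (λ _ _ ()) _
T-not-∧∧ false b     c     = mk⇔ (λ _ ()) _

T-all : ∀ {A : Set} (p : A → Bool) {xs : List A} → (∀ x → x ∈ xs) → T (all p xs) ⇔ (∀ x → T (p x))
T-all p {xs} ∈xs = mk⇔ (λ h x → All.lookup (all⁺ p xs h) (∈xs x))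
                       (λ h → all⁻ p {xs} (All.tabulate (λ {x} _ → h x)))

length-filterᵇ-++ : ∀ {A : Set} (P : A → Bool) xs ys →
  length (filterᵇ P (xs ++ ys)) ≡ length (filterᵇ P xs) + length (filterᵇ P ys)
length-filterᵇ-++ P xs ys = trans (cong length (filter-++ (T? ∘ P) xs ys)) (length-++ (filterᵇ P xs))

length-filterᵇ-map : ∀ {A B : Set} (P : B → Bool) (f : A → B) xs →
  length (filterᵇ P (map f xs)) ≡ length (filterᵇ (P ∘ f) xs)
length-filterᵇ-map P f []       = refl
length-filterᵇ-map P f (x ∷ xs) with P (f x)
... | true  = cong suc (length-filterᵇ-map P f xs)
... | false = length-filterᵇ-map P f xs

length-filterᵇ-tabulate : ∀ {A : Set} {n} (P : A → Bool) (f : Fin n → A) →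
  length (filterᵇ P (tabulate f)) ≡ ∑[ i < n ] iverson (P (f i))
length-filterᵇ-tabulate {n = zero}  P f = refl
length-filterᵇ-tabulate {n = suc n} P f with P (f zero)
... | true  = cong suc (length-filterᵇ-tabulate P (f ∘ suc))
... | false = length-filterᵇ-tabulate P (f ∘ suc)

length-filterᵇ-concat-tabulate : ∀ {A : Set} {n} (P : A → Bool) (g : Fin n → List A) →
  length (filterᵇ P (concat (tabulate g))) ≡ ∑[ i < n ] length (filterᵇ P (g i))
length-filterᵇ-concat-tabulate {n = zero}  P g = refl
length-filterᵇ-concat-tabulate {n = suc n} P g =
  trans (length-filterᵇ-++ P (g zero) _)
        (cong (length (filterᵇ P (g zero)) +_) (length-filterᵇ-concat-tabulate P (g ∘ suc)))

-- Sums over all subsets of Fin n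

∑ˢ : ∀ n → (Subset n → ℕ) → ℕ
∑ˢ zero    f = f []
∑ˢ (suc n) f = ∑ˢ n (f ∘ (outside ∷_)) + ∑ˢ n (f ∘ (inside ∷_))

∑ˢ-mono-≤ : ∀ {n} {f g : Subset n → ℕ} → (∀ S → f S ≤ g S) → ∑ˢ n f ≤ ∑ˢ n g
∑ˢ-mono-≤ {zero}  f≤g = f≤g []
∑ˢ-mono-≤ {suc n} f≤g =
  +-mono-≤ (∑ˢ-mono-≤ {n} (f≤g ∘ (outside ∷_))) (∑ˢ-mono-≤ {n} (f≤g ∘ (inside ∷_)))

∑ˢ-cong : ∀ {n} {f g : Subset n → ℕ} → (∀ S → f S ≡ g S) → ∑ˢ n f ≡ ∑ˢ n g
∑ˢ-cong f≗g = ≤-antisym (∑ˢ-mono-≤ (≤-reflexive ∘ f≗g)) (∑ˢ-mono-≤ (≤-reflexive ∘ sym ∘ f≗g))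

∑ˢ-distrib-+ : ∀ {n} (f g : Subset n → ℕ) → ∑ˢ n (λ S → f S + g S) ≡ ∑ˢ n f + ∑ˢ n g
∑ˢ-distrib-+ {zero}  f g = refl
∑ˢ-distrib-+ {suc n} f g = trans
  (cong₂ _+_ (∑ˢ-distrib-+ (f ∘ (outside ∷_)) (g ∘ (outside ∷_)))
             (∑ˢ-distrib-+ (f ∘ (inside ∷_)) (g ∘ (inside ∷_))))
  (+-interchange (∑ˢ n (f ∘ (outside ∷_))) _ _ _)

≤-∑ˢ : ∀ {n} (f : Subset n → ℕ) S → f S ≤ ∑ˢ n f
≤-∑ˢ f []          = ≤-refl
≤-∑ˢ f (false ∷ S) = ≤-trans (≤-∑ˢ (f ∘ (outside ∷_)) S) (m≤m+n _ _)
≤-∑ˢ f (true  ∷ S) = ≤-trans (≤-∑ˢ (f ∘ (inside ∷_)) S) (m≤n+m _ _)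

-- S ↦ S ∪ {v} is injective on the subsets avoiding v.
∑ˢ-insert : ∀ {n} (v : Fin n) (f : Subset n → ℕ) →
  ∑ˢ n (λ S → iverson (not (lookup S v)) * f (S [ v ]≔ inside)) ≤ ∑ˢ n f
∑ˢ-insert {suc n} zero f = begin
  ∑ˢ n (λ S → f (inside ∷ S) + 0) + ∑ˢ n (λ _ → 0)
    ≤⟨ +-mono-≤ (∑ˢ-mono-≤ {n} (λ S → ≤-reflexive (+-identityʳ _)))
                (∑ˢ-mono-≤ {n} (λ _ → z≤n)) ⟩
  ∑ˢ n (f ∘ (inside ∷_)) + ∑ˢ n (f ∘ (outside ∷_))
    ≡⟨ +-comm (∑ˢ n (f ∘ (inside ∷_))) _ ⟩
  ∑ˢ (suc n) f ∎
  where open ≤-Reasoning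
∑ˢ-insert {suc n} (suc v) f =
  +-mono-≤ (∑ˢ-insert v (f ∘ (outside ∷_))) (∑ˢ-insert v (f ∘ (inside ∷_)))

countSubsets : ∀ n → (Subset n → Bool) → ℕ
countSubsets n P = ∑ˢ n (iverson ∘ P)

length-filterᵇ-allSubsets : ∀ n (P : Subset n → Bool) →
  length (filterᵇ P (allSubsets n)) ≡ countSubsets n P
length-filterᵇ-allSubsets zero P with P []
... | true  = refl
... | false = refl
length-filterᵇ-allSubsets (suc n) P = trans
  (length-filterᵇ-++ P (map (outside ∷_) (allSubsets n)) _)
  (cong₂ _+_ (trans (length-filterᵇ-map P (outside ∷_) (allSubsets n)) (length-filterᵇ-allSubsets n _))
             (trans (length-filterᵇ-map P (inside ∷_) (allSubsets n)) (length-filterᵇ-allSubsets n _)))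

countSubsets-mono : ∀ {n} {P Q : Subset n → Bool} → (∀ S → T (P S) → T (Q S)) →
  countSubsets n P ≤ countSubsets n Q
countSubsets-mono {n} P⇒Q = ∑ˢ-mono-≤ {n} (λ S → iverson-mono (P⇒Q S))

countSubsets-split : ∀ {n} (P Q : Subset n → Bool) →
  countSubsets n P ≡ countSubsets n (λ S → P S ∧ Q S) + countSubsets n (λ S → P S ∧ not (Q S))
countSubsets-split {n} P Q =
  trans (∑ˢ-cong {n} (λ S → iverson-split (P S) (Q S))) (∑ˢ-distrib-+ {n} _ _)

countSubsets-insert : ∀ {n} (v : Fin n) (P : Subset n → Bool) →
  countSubsets n (λ S → not (lookup S v) ∧ P (S [ v ]≔ inside)) ≤ countSubsets n P
countSubsets-insert {n} v P = ≤-trans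
  (∑ˢ-mono-≤ {n} (λ S → ≤-reflexive (iverson-∧ (not (lookup S v)) _)))
  (∑ˢ-insert v (iverson ∘ P))

countSubsets-pos : ∀ {n} (P : Subset n → Bool) S → T (P S) → 1 ≤ countSubsets n P
countSubsets-pos P S PS = ≤-trans (iverson-mono {true} (λ _ → PS)) (≤-∑ˢ (iverson ∘ P) S)

∑-mono-≤ : ∀ {n} {f g : Fin n → ℕ} → (∀ i → f i ≤ g i) → sum f ≤ sum g
∑-mono-≤ {zero}  _   = z≤n
∑-mono-≤ {suc n} f≤g = +-mono-≤ (f≤g zero) (∑-mono-≤ (f≤g ∘ suc))

≤-∑ : ∀ {n} (f : Fin n → ℕ) i → f i ≤ sum f
≤-∑ f zero    = m≤m+n _ _
≤-∑ f (suc i) = ≤-trans (≤-∑ (f ∘ suc) i) (m≤n+m _ _)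

∣_∣ : ∀ {n} → (Fin n → Bool) → ℕ
∣_∣ {n} U = ∑[ i < n ] iverson (U i)

infixr 7 _∩_
infixr 6 _∪_ _─_

_∩_ _∪_ _─_ : ∀ {n} → (Fin n → Bool) → (Fin n → Bool) → Fin n → Bool
(U ∩ W) i = U i ∧ W i
(U ∪ W) i = U i ∨ W i
(U ─ W) i = U i ∧ not (W i)

⊤ : ∀ {n} → Fin n → Bool
⊤ _ = true

⁅_⁆ : ∀ {n} → Fin n → Fin n → Bool
⁅ v ⁆ i = ⌊ i ≟ v ⌋

v∈⁅v⁆ : ∀ {n} (v : Fin n) → T (⁅ v ⁆ v)
v∈⁅v⁆ v = fromWitness refl

T-─ : ∀ {n} (U W : Fin n → Bool) i → T ((U ─ W) i) → T (U i) × ¬ T (W i)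
T-─ U W i h = let Ui , ¬Wi = to T-∧ h in Ui , to (T-not (W i)) ¬Wi

∣∣-mono : ∀ {n} {U W : Fin n → Bool} → (∀ i → T (U i) → T (W i)) → ∣ U ∣ ≤ ∣ W ∣
∣∣-mono U⊆W = ∑-mono-≤ (λ i → iverson-mono (U⊆W i))

∣∣-split : ∀ {n} (U W : Fin n → Bool) → ∣ U ∣ ≡ ∣ U ∩ W ∣ + ∣ U ─ W ∣
∣∣-split U W = trans (sum-cong-≗ (λ i → iverson-split (U i) (W i)))
                     (∑-distrib-+ (iverson ∘ (U ∩ W)) (iverson ∘ (U ─ W)))

∣∪∣≤∣∣+∣∣ : ∀ {n} (U W : Fin n → Bool) → ∣ U ∪ W ∣ ≤ ∣ U ∣ + ∣ W ∣
∣∪∣≤∣∣+∣∣ U W = ≤-trans (∑-mono-≤ (λ i → iverson-∨ (U i) (W i)))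
                        (≤-reflexive (∑-distrib-+ (iverson ∘ U) (iverson ∘ W)))

∣⊤∣≡n : ∀ n → ∣ ⊤ {n} ∣ ≡ n
∣⊤∣≡n zero    = refl
∣⊤∣≡n (suc n) = cong suc (∣⊤∣≡n n)

∣⁅⁆∣≡1 : ∀ {n} (v : Fin n) → ∣ ⁅ v ⁆ ∣ ≡ 1
∣⁅⁆∣≡1 {suc n} zero    = cong suc (∣⁅0⁆∘suc∣≡0 n)
  where
  ∣⁅0⁆∘suc∣≡0 : ∀ m → ∣ (λ (i : Fin m) → ⁅ zero ⁆ (suc i)) ∣ ≡ 0
  ∣⁅0⁆∘suc∣≡0 zero    = refl
  ∣⁅0⁆∘suc∣≡0 (suc m) = ∣⁅0⁆∘suc∣≡0 m
∣⁅⁆∣≡1 {suc n} (suc v) = trans (sum-cong-≗ (cong iverson ∘ ⁅suc⁆∘suc)) (∣⁅⁆∣≡1 v)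
  where
  ⁅suc⁆∘suc : ∀ i → ⁅ suc v ⁆ (suc i) ≡ ⁅ v ⁆ i
  ⁅suc⁆∘suc i with i ≟ v
  ... | yes _ = refl
  ... | no  _ = refl

∣∣≡1+∣─⁅⁆∣ : ∀ {n} (U : Fin n → Bool) {v} → T (U v) → ∣ U ∣ ≡ suc ∣ U ─ ⁅ v ⁆ ∣
∣∣≡1+∣─⁅⁆∣ U {v} v∈U = trans (∣∣-split U ⁅ v ⁆) (cong (_+ ∣ U ─ ⁅ v ⁆ ∣) ∣U∩⁅v⁆∣≡1)
  where
  ∣U∩⁅v⁆∣≡1 : ∣ U ∩ ⁅ v ⁆ ∣ ≡ 1
  ∣U∩⁅v⁆∣≡1 = ≤-antisym
    (≤-trans (∣∣-mono {W = ⁅ v ⁆} (λ i → proj₂ ∘ to T-∧)) (≤-reflexive (∣⁅⁆∣≡1 v)))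
    (≤-trans (iverson-mono {true} (λ _ → from T-∧ (v∈U , v∈⁅v⁆ v)))
             (≤-∑ (iverson ∘ (U ∩ ⁅ v ⁆)) v))

0<∣∣⇒∃ : ∀ {n} (U : Fin n → Bool) → 0 < ∣ U ∣ → ∃ λ v → T (U v)
0<∣∣⇒∃ {suc n} U 0<∣U∣ with U zero in U0
... | true  = zero , subst T (sym U0) _
... | false = let v , v∈U = 0<∣∣⇒∃ (U ∘ suc) 0<∣U∣ in suc v , v∈U

-- Binomial coefficients

nCk≤[1+n]Ck : ∀ n k → n C k ≤ suc n C k
nCk≤[1+n]Ck n zero    = ≤-refl
nCk≤[1+n]Ck n (suc k) =
  ≤-trans (m≤n+m (n C suc k) (n C k)) (≤-reflexive (nCk+nC[k+1]≡[n+1]C[k+1] n k))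

nCk≤[n+m]Ck : ∀ n m k → n C k ≤ (n + m) C k
nCk≤[n+m]Ck n zero    k = ≤-reflexive (cong (_C k) (sym (+-identityʳ n)))
nCk≤[n+m]Ck n (suc m) k = begin
  n C k             ≤⟨ nCk≤[n+m]Ck n m k ⟩
  (n + m) C k       ≤⟨ nCk≤[1+n]Ck (n + m) k ⟩
  suc (n + m) C k   ≡⟨ cong (_C k) (+-suc n m) ⟨
  (n + suc m) C k   ∎
  where open ≤-Reasoning

m*nCk≤[n+m]C[1+k] : ∀ m n k → m * (n C k) ≤ (n + m) C suc k
m*nCk≤[n+m]C[1+k] zero    n k = z≤n
m*nCk≤[n+m]C[1+k] (suc m) n k = begin
  n C k + m * (n C k)             ≤⟨ +-mono-≤ (nCk≤[n+m]Ck n m k) (m*nCk≤[n+m]C[1+k] m n k) ⟩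
  (n + m) C k + (n + m) C suc k   ≡⟨ nCk+nC[k+1]≡[n+1]C[k+1] (n + m) k ⟩
  suc (n + m) C suc k             ≡⟨ cong (_C suc k) (+-suc n m) ⟨
  (n + suc m) C suc k             ∎
  where open ≤-Reasoning

m^k≤[k*m]Ck : ∀ m k → m ^ k ≤ (k * m) C k
m^k≤[k*m]Ck m zero    = ≤-refl
m^k≤[k*m]Ck m (suc k) = begin
  m * m ^ k            ≤⟨ *-monoʳ-≤ m (m^k≤[k*m]Ck m k) ⟩
  m * ((k * m) C k)    ≤⟨ m*nCk≤[n+m]C[1+k] m (k * m) k ⟩
  (k * m + m) C suc k  ≡⟨ cong (_C suc k) (+-comm (k * m) m) ⟩
  (suc k * m) C suc k  ∎
  where open ≤-Reasoning

-- Independent sets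

_⊆_ : ∀ {n} → Subset n → (Fin n → Bool) → Set
S ⊆ U = ∀ i → T (lookup S i) → T (U i)

_⊆ᵇ_ : ∀ {n} → Subset n → (Fin n → Bool) → Bool
_⊆ᵇ_ {n} S U = all (λ i → not (lookup S i) ∨ U i) (allFin n)

Independent : ∀ {n} → Graph n → Subset n → Set
Independent G S = ∀ i j → T (lookup S i) → T (lookup S j) → ¬ T (adj G i j)

IndependentIn : ∀ {n} → Graph n → (Fin n → Bool) → Subset n → Set
IndependentIn G U S = S ⊆ U × Independent G S

∈-pairs : ∀ {n} (ij : Fin n × Fin n) → ij ∈ pairs n
∈-pairs {n} (i , j) =
  ∈-concat⁺′ (∈-map⁺ (i ,_) (∈-allFin j)) (∈-map⁺ (λ i → map (i ,_) (allFin n)) (∈-allFin i))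

⊆ᵇ⇔⊆ : ∀ {n} (S : Subset n) U → T (S ⊆ᵇ U) ⇔ S ⊆ U
⊆ᵇ⇔⊆ S U = mk⇔
  (λ h i → to (T-not-∨ (lookup S i) (U i)) (to (T-all _ ∈-allFin) h i))
  (λ h → from (T-all _ ∈-allFin) (λ i → from (T-not-∨ (lookup S i) (U i)) (h i)))

independentᵇ⇔Independent : ∀ {n} (G : Graph n) S → T (independentᵇ G S) ⇔ Independent G S
independentᵇ⇔Independent G S = mk⇔
  (λ h i j → to (T-not-∧∧ _ _ _) (to (T-all _ ∈-pairs) h (i , j)))
  (λ h → from (T-all _ ∈-pairs) (λ (i , j) → from (T-not-∧∧ _ _ _) (h i j)))

independentInᵇ : ∀ {n} → Graph n → (Fin n → Bool) → Subset n → Bool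
independentInᵇ G U S = S ⊆ᵇ U ∧ independentᵇ G S

independentInᵇ⇔IndependentIn : ∀ {n} (G : Graph n) U S → T (independentInᵇ G U S) ⇔ IndependentIn G U S
independentInᵇ⇔IndependentIn G U S = mk⇔
  (λ h → let S⊆U , indS = to T-∧ h in to (⊆ᵇ⇔⊆ S U) S⊆U , to (independentᵇ⇔Independent G S) indS)
  (λ (S⊆U , indS) → from T-∧ (from (⊆ᵇ⇔⊆ S U) S⊆U , from (independentᵇ⇔Independent G S) indS))

numIndepIn : ∀ {n} → Graph n → (Fin n → Bool) → ℕ
numIndepIn {n} G U = countSubsets n (independentInᵇ G U)

numIndepIn≤numIndep : ∀ {n} (G : Graph n) U → numIndepIn G U ≤ numIndep G
numIndepIn≤numIndep {n} G U = begin
  numIndepIn G U                    ≤⟨ countSubsets-mono {n} {independentInᵇ G U} (λ S → proj₂ ∘ to T-∧) ⟩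
  countSubsets n (independentᵇ G)   ≡⟨ length-filterᵇ-allSubsets n (independentᵇ G) ⟨
  numIndep G                        ∎
  where open ≤-Reasoning

numIndepIn-pos : ∀ {n} (G : Graph n) U → 1 ≤ numIndepIn G U
numIndepIn-pos {n} G U = countSubsets-pos (independentInᵇ G U) ∅
  (from (independentInᵇ⇔IndependentIn G U ∅) (∅⊆U , ∅-independent))
  where
  ∅ : Subset n
  ∅ = replicate n outside
  ∉∅ : ∀ i → ¬ T (lookup ∅ i)
  ∉∅ i = subst (¬_ ∘ T) (sym (lookup-replicate i outside)) λ ()
  ∅⊆U : ∅ ⊆ U
  ∅⊆U i i∈∅ = ⊥-elim (∉∅ i i∈∅)
  ∅-independent : Independent G ∅
  ∅-independent i _ i∈∅ = ⊥-elim (∉∅ i i∈∅)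

∈-insert⁻ : ∀ {n} (S : Subset n) {v i} → i ≢ v → T (lookup (S [ v ]≔ inside) i) → T (lookup S i)
∈-insert⁻ S i≢v = subst T (lookup∘update′ i≢v S inside)

insert-⊆ : ∀ {n} {S : Subset n} {U v} → S ⊆ U → T (U v) → (S [ v ]≔ inside) ⊆ U
insert-⊆ {S = S} {v = v} S⊆U v∈U i i∈S′ with i ≟ v
... | yes refl = v∈U
... | no  i≢v  = S⊆U i (∈-insert⁻ S i≢v i∈S′)

insert-independent : ∀ {n} (G : Graph n) {S v} → Independent G S →
  (∀ j → T (lookup S j) → ¬ T (adj G v j)) → Independent G (S [ v ]≔ inside)
insert-independent G {S} {v} indS v≁S i j i∈S′ j∈S′ with i ≟ v | j ≟ v
... | yes refl | yes refl = subst (¬_ ∘ T) (sym (Graph.irrefl G v)) λ ()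
... | yes refl | no  j≢v  = v≁S j (∈-insert⁻ S j≢v j∈S′)
... | no  i≢v  | yes refl = subst (¬_ ∘ T) (Graph.sym G v i) (v≁S i (∈-insert⁻ S i≢v i∈S′))
... | no  i≢v  | no  j≢v  = indS i j (∈-insert⁻ S i≢v i∈S′) (∈-insert⁻ S j≢v j∈S′)

closedNbhd : ∀ {n} → Graph n → Fin n → Fin n → Bool
closedNbhd G v = ⁅ v ⁆ ∪ adj G v

IndependentIn-─⁅⁆ : ∀ {n} (G : Graph n) U v S →
  IndependentIn G (U ─ ⁅ v ⁆) S → IndependentIn G U S × ¬ T (lookup S v)
IndependentIn-─⁅⁆ G U v S (S⊆ , indS) =
  ((λ i → proj₁ ∘ T-─ U ⁅ v ⁆ i ∘ S⊆ i) , indS) ,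
  (λ v∈S → proj₂ (T-─ U ⁅ v ⁆ v (S⊆ v v∈S)) (v∈⁅v⁆ v))

IndependentIn-─closedNbhd : ∀ {n} (G : Graph n) U {v} S → T (U v) →
  IndependentIn G (U ─ closedNbhd G v) S → ¬ T (lookup S v) × IndependentIn G U (S [ v ]≔ inside)
IndependentIn-─closedNbhd {n} G U {v} S v∈U (S⊆ , indS) =
  (λ v∈S → ∉N v v∈S (from (T-∨ {⁅ v ⁆ v}) (inj₁ (v∈⁅v⁆ v)))) ,
  insert-⊆ {S = S} (λ i → proj₁ ∘ T-─ U N i ∘ S⊆ i) v∈U ,
  insert-independent G {S} {v} indS (λ j j∈S → ∉N j j∈S ∘ from (T-∨ {⁅ v ⁆ j}) ∘ inj₂)
  where
  N : Fin n → Bool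
  N = closedNbhd G v
  ∉N : ∀ j → T (lookup S j) → ¬ T (N j)
  ∉N j = proj₂ ∘ T-─ U N j ∘ S⊆ j

numIndepIn-delete : ∀ {n} (G : Graph n) U {v} → T (U v) →
  numIndepIn G (U ─ ⁅ v ⁆) + numIndepIn G (U ─ closedNbhd G v) ≤ numIndepIn G U
numIndepIn-delete {n} G U {v} v∈U = begin
  numIndepIn G (U ─ ⁅ v ⁆) + numIndepIn G (U ─ closedNbhd G v)
    ≤⟨ +-mono-≤ (countSubsets-mono avoiding) (countSubsets-mono insertable) ⟩
  countSubsets n without + countSubsets n (λ S → not (lookup S v) ∧ with′ (S [ v ]≔ inside))
    ≤⟨ +-monoʳ-≤ (countSubsets n without) (countSubsets-insert v with′) ⟩
  countSubsets n without + countSubsets n with′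
    ≡⟨ +-comm (countSubsets n without) _ ⟩
  countSubsets n with′ + countSubsets n without
    ≡⟨ countSubsets-split I (λ S → lookup S v) ⟨
  numIndepIn G U ∎
  where
  open ≤-Reasoning
  I with′ without : Subset n → Bool
  I = independentInᵇ G U
  with′ S = I S ∧ lookup S v
  without S = I S ∧ not (lookup S v)
  avoiding : ∀ S → T (independentInᵇ G (U ─ ⁅ v ⁆) S) → T (without S)
  avoiding S h =
    let indS , v∉S = IndependentIn-─⁅⁆ G U v S (to (independentInᵇ⇔IndependentIn G _ S) h)
    in from T-∧ (from (independentInᵇ⇔IndependentIn G U S) indS , from (T-not (lookup S v)) v∉S)
  insertable : ∀ S → T (independentInᵇ G (U ─ closedNbhd G v) S) →
               T (not (lookup S v) ∧ with′ (S [ v ]≔ inside))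
  insertable S h =
    let v∉S , indS+v = IndependentIn-─closedNbhd G U {v} S v∈U (to (independentInᵇ⇔IndependentIn G _ S) h)
    in from T-∧ ( from (T-not (lookup S v)) v∉S
                , from T-∧ ( from (independentInᵇ⇔IndependentIn G U (S [ v ]≔ inside)) indS+v
                           , subst T (sym (lookup∘update v S inside)) _))

-- Degrees

deg : ∀ {n} → Graph n → Fin n → ℕ
deg G v = ∣ adj G v ∣

∣∣≤1+deg+∣─closedNbhd∣ : ∀ {n} (G : Graph n) U v → ∣ U ∣ ≤ suc (deg G v) + ∣ U ─ closedNbhd G v ∣
∣∣≤1+deg+∣─closedNbhd∣ {n} G U v = begin
  ∣ U ∣                              ≡⟨ ∣∣-split U N ⟩
  ∣ U ∩ N ∣ + ∣ U ─ N ∣              ≤⟨ +-monoˡ-≤ _ (∣∣-mono {W = N} (λ i → proj₂ ∘ to T-∧)) ⟩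
  ∣ N ∣ + ∣ U ─ N ∣                  ≤⟨ +-monoˡ-≤ _ (∣∪∣≤∣∣+∣∣ ⁅ v ⁆ (adj G v)) ⟩
  ∣ ⁅ v ⁆ ∣ + deg G v + ∣ U ─ N ∣    ≡⟨ cong (λ x → x + deg G v + ∣ U ─ N ∣) (∣⁅⁆∣≡1 v) ⟩
  suc (deg G v) + ∣ U ─ N ∣          ∎
  where
  open ≤-Reasoning
  N : Fin n → Bool
  N = closedNbhd G v

C≤numIndepIn : ∀ {n} (G : Graph n) Δ U → (∀ v → T (U v) → deg G v ≤ Δ) →
  ∀ a k → a + k * Δ ≤ ∣ U ∣ → a C k ≤ numIndepIn G U
C≤numIndepIn G Δ U maxDeg zero    zero    _    = numIndepIn-pos G U
C≤numIndepIn G Δ U maxDeg zero    (suc k) _    = z≤n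
C≤numIndepIn G Δ U maxDeg (suc a) zero    _    = numIndepIn-pos G U
C≤numIndepIn {n} G Δ U maxDeg (suc a) (suc k) size with 0<∣∣⇒∃ U (≤-trans (s≤s z≤n) size)
... | v , v∈U = begin
  suc a C suc k                         ≡⟨ nCk+nC[k+1]≡[n+1]C[k+1] a k ⟨
  a C k + a C suc k                     ≤⟨ +-mono-≤ (C≤numIndepIn G Δ U─N (inherit _) a k size-N)
                                                    (C≤numIndepIn G Δ U─v (inherit _) a (suc k) size-v) ⟩
  numIndepIn G U─N + numIndepIn G U─v   ≡⟨ +-comm (numIndepIn G U─N) _ ⟩
  numIndepIn G U─v + numIndepIn G U─N   ≤⟨ numIndepIn-delete G U v∈U ⟩
  numIndepIn G U                        ∎
  where
  open ≤-Reasoning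
  U─v U─N : Fin n → Bool
  U─v = U ─ ⁅ v ⁆
  U─N = U ─ closedNbhd G v
  inherit : ∀ W w → T ((U ─ W) w) → deg G w ≤ Δ
  inherit W w = maxDeg w ∘ proj₁ ∘ T-─ U W w
  size-v : a + suc k * Δ ≤ ∣ U─v ∣
  size-v = ≤-pred (≤-trans size (≤-reflexive (∣∣≡1+∣─⁅⁆∣ U v∈U)))
  swap : ∀ x y z → suc x + (y + z) ≡ suc y + (x + z)
  swap = solve-∀
  size-N : a + k * Δ ≤ ∣ U─N ∣
  size-N = +-cancelˡ-≤ (suc Δ) _ _ (begin
    suc Δ + (a + k * Δ)        ≡⟨ swap Δ a (k * Δ) ⟩
    suc a + suc k * Δ          ≤⟨ size ⟩
    ∣ U ∣                      ≤⟨ ∣∣≤1+deg+∣─closedNbhd∣ G U v ⟩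
    suc (deg G v) + ∣ U─N ∣    ≤⟨ +-monoˡ-≤ _ (s≤s (maxDeg v v∈U)) ⟩
    suc Δ + ∣ U─N ∣            ∎)

edgeᵇ : ∀ {n} → Graph n → Fin n → Fin n → Bool
edgeᵇ G i j = (toℕ i <ᵇ toℕ j) ∧ adj G i j

edges≡∑∑edgeᵇ : ∀ {n} (G : Graph n) → edges G ≡ ∑[ i < n ] ∑[ j < n ] iverson (edgeᵇ G i j)
edges≡∑∑edgeᵇ {n} G = begin
  edges G
    ≡⟨ cong (length ∘ filterᵇ E ∘ concat) (map-tabulate id row) ⟩
  length (filterᵇ E (concat (tabulate row)))
    ≡⟨ length-filterᵇ-concat-tabulate E row ⟩
  ∑[ i < n ] length (filterᵇ E (row i))
    ≡⟨ sum-cong-≗ (λ i → trans (length-filterᵇ-map E (i ,_) (allFin n))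
                               (length-filterᵇ-tabulate (edgeᵇ G i) id)) ⟩
  ∑[ i < n ] ∑[ j < n ] iverson (edgeᵇ G i j) ∎
  where
  open ≡-Reasoning
  E : Fin n × Fin n → Bool
  E (i , j) = edgeᵇ G i j
  row : Fin n → List (Fin n × Fin n)
  row i = map (i ,_) (allFin n)

adj≤edgeᵇ+edgeᵇ : ∀ {n} (G : Graph n) i j →
  iverson (adj G i j) ≤ iverson (edgeᵇ G i j) + iverson (edgeᵇ G j i)
adj≤edgeᵇ+edgeᵇ G i j with toℕ i <ᵇ toℕ j in i<j | toℕ j <ᵇ toℕ i in j<i
... | true  | _     = m≤m+n _ _
... | false | true  = ≤-trans (≤-reflexive (cong iverson (Graph.sym G i j))) (m≤n+m _ _)
... | false | false = ≤-reflexive (cong iverson (trans (cong (adj G i) (sym i≡j)) (Graph.irrefl G i)))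
  where
  i≡j : i ≡ j
  i≡j = toℕ-injective (≤-antisym (≮⇒≥ (subst T j<i ∘ <⇒<ᵇ)) (≮⇒≥ (subst T i<j ∘ <⇒<ᵇ)))

∑deg≤2*edges : ∀ {n} (G : Graph n) → ∑[ v < n ] deg G v ≤ 2 * edges G
∑deg≤2*edges {n} G = begin
  ∑[ i < n ] ∑[ j < n ] iverson (adj G i j)
    ≤⟨ ∑-mono-≤ (λ i → ∑-mono-≤ (adj≤edgeᵇ+edgeᵇ G i)) ⟩
  ∑[ i < n ] ∑[ j < n ] (E i j + E j i)
    ≡⟨ sum-cong-≗ (λ i → ∑-distrib-+ (E i) (λ j → E j i)) ⟩
  ∑[ i < n ] (∑[ j < n ] E i j + ∑[ j < n ] E j i)
    ≡⟨ ∑-distrib-+ (λ i → ∑[ j < n ] E i j) (λ i → ∑[ j < n ] E j i) ⟩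
  ∑[ i < n ] ∑[ j < n ] E i j + ∑[ i < n ] ∑[ j < n ] E j i
    ≡⟨ cong (∑[ i < n ] ∑[ j < n ] E i j +_) (∑-comm (λ i j → E j i)) ⟩
  ∑[ i < n ] ∑[ j < n ] E i j + ∑[ j < n ] ∑[ i < n ] E j i
    ≡⟨ cong (λ e → e + e) (edges≡∑∑edgeᵇ G) ⟨
  edges G + edges G
    ≡⟨ cong (edges G +_) (+-identityʳ (edges G)) ⟨
  2 * edges G ∎
  where
  open ≤-Reasoning
  E : Fin n → Fin n → ℕ
  E i j = iverson (edgeᵇ G i j)

lowDegree highDegree : ∀ {n} → Graph n → ℕ → Fin n → Bool
lowDegree G Δ v = deg G v ≤ᵇ Δ
highDegree G Δ = ⊤ ─ lowDegree G Δ

[1+Δ]*∣highDegree∣≤2*edges : ∀ {n} (G : Graph n) Δ → suc Δ * ∣ highDegree G Δ ∣ ≤ 2 * edges G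
[1+Δ]*∣highDegree∣≤2*edges {n} G Δ = begin
  suc Δ * ∣ highDegree G Δ ∣                            ≡⟨ *-distribˡ-sum (suc Δ) (iverson ∘ highDegree G Δ) ⟩
  ∑[ v < n ] (suc Δ * iverson (highDegree G Δ v))      ≤⟨ ∑-mono-≤ high⇒>Δ ⟩
  ∑[ v < n ] deg G v                                    ≤⟨ ∑deg≤2*edges G ⟩
  2 * edges G                                           ∎
  where
  open ≤-Reasoning
  high⇒>Δ : ∀ v → suc Δ * iverson (highDegree G Δ v) ≤ deg G v
  high⇒>Δ v with deg G v ≤ᵇ Δ in low
  ... | true  = ≤-trans (≤-reflexive (*-zeroʳ (suc Δ))) z≤n
  ... | false = ≤-trans (≤-reflexive (*-identityʳ (suc Δ))) (≰⇒> (subst T low ∘ ≤⇒≤ᵇ))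

n≤2*∣lowDegree∣ : ∀ {n} (G : Graph n) Δ → 2 * (2 * edges G) < suc Δ * n → n ≤ 2 * ∣ lowDegree G Δ ∣
n≤2*∣lowDegree∣ {n} G Δ 4e<[1+Δ]n = begin
  n          ≡⟨ n≡u+h ⟩
  u + h      ≤⟨ +-monoʳ-≤ u (<⇒≤ h<u) ⟩
  u + u      ≡⟨ cong (u +_) (+-identityʳ u) ⟨
  2 * u      ∎
  where
  open ≤-Reasoning
  u h : ℕ
  u = ∣ lowDegree G Δ ∣
  h = ∣ highDegree G Δ ∣
  n≡u+h : n ≡ u + h
  n≡u+h = trans (sym (∣⊤∣≡n n)) (∣∣-split ⊤ (lowDegree G Δ))
  x*[2*y]≡2*[x*y] : ∀ x y → x * (2 * y) ≡ 2 * (x * y)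
  x*[2*y]≡2*[x*y] = solve-∀
  2h<n : 2 * h < n
  2h<n = *-cancelˡ-< (suc Δ) _ _ (begin-strict
    suc Δ * (2 * h)          ≡⟨ x*[2*y]≡2*[x*y] (suc Δ) h ⟩
    2 * (suc Δ * h)          ≤⟨ *-monoʳ-≤ 2 ([1+Δ]*∣highDegree∣≤2*edges G Δ) ⟩
    2 * (2 * edges G)        <⟨ 4e<[1+Δ]n ⟩
    suc Δ * n                ∎)
  h<u : h < u
  h<u = +-cancelʳ-< h h u (begin-strict
    h + h        ≡⟨ cong (h +_) (+-identityʳ h) ⟨
    2 * h        <⟨ 2h<n ⟩
    n            ≡⟨ n≡u+h ⟩
    u + h        ∎)

[1+p]^[n/6[1+p]]≤numIndep : ∀ {n} (G : Graph n) p → 2 * edges G < suc p * n →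
  suc p ^ (n / (6 * suc p)) ≤ numIndep G
[1+p]^[n/6[1+p]]≤numIndep {n} G p D<[1+p]n = begin
  s ^ k              ≤⟨ m^k≤[k*m]Ck s k ⟩
  (k * s) C k        ≤⟨ C≤numIndepIn G Δ U (λ v → ≤ᵇ⇒≤ (deg G v) Δ) (k * s) k fits ⟩
  numIndepIn G U     ≤⟨ numIndepIn≤numIndep G U ⟩
  numIndep G         ∎
  where
  open ≤-Reasoning
  s Δ k : ℕ
  s = suc p
  Δ = p + s
  k = n / (6 * s)
  U : Fin n → Bool
  U = lowDegree G Δ
  2[ks+kΔ]+2k≡k*6s : ∀ k p → 2 * (k * suc p + k * (p + suc p)) + 2 * k ≡ k * (6 * suc p)
  2[ks+kΔ]+2k≡k*6s = solve-∀
  2*[s*n]≡[1+Δ]*n : ∀ p n → 2 * (suc p * n) ≡ suc (p + suc p) * n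
  2*[s*n]≡[1+Δ]*n = solve-∀
  fits : k * s + k * Δ ≤ ∣ U ∣
  fits = *-cancelˡ-≤ 2 (begin
    2 * (k * s + k * Δ)           ≤⟨ m≤m+n _ (2 * k) ⟩
    2 * (k * s + k * Δ) + 2 * k   ≡⟨ 2[ks+kΔ]+2k≡k*6s k p ⟩
    k * (6 * s)                   ≤⟨ m/n*n≤m n (6 * s) ⟩
    n                             ≤⟨ n≤2*∣lowDegree∣ G Δ (begin-strict
      2 * (2 * edges G)               <⟨ *-monoʳ-< 2 D<[1+p]n ⟩
      2 * (s * n)                     ≡⟨ 2*[s*n]≡[1+Δ]*n p n ⟩
      suc Δ * n                       ∎) ⟩
    2 * ∣ U ∣                     ∎)

m<[1+m/n]*n : ∀ m n .{{_ : NonZero n}} → m < suc (m / n) * n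
m<[1+m/n]*n m n = begin-strict
  m                    ≡⟨ m≡m%n+[m/n]*n m n ⟩
  m % n + m / n * n    <⟨ +-monoˡ-< (m / n * n) (m%n<n m n) ⟩
  n + m / n * n        ∎
  where open ≤-Reasoning

1+m≤2*m : ∀ {m} → 1 ≤ m → suc m ≤ 2 * m
1+m≤2*m {m} 1≤m = ≤-trans (+-monoˡ-≤ m 1≤m) (≤-reflexive (cong (m +_) (sym (+-identityʳ m))))

n≤24*[p*[n/6[1+p]]] : ∀ n p → 1 ≤ p → 6 * suc p ≤ n → n ≤ 24 * (p * (n / (6 * suc p)))
n≤24*[p*[n/6[1+p]]] n p 1≤p 6[1+p]≤n = <⇒≤ (begin-strict
  n                          <⟨ m<[1+m/n]*n n (6 * suc p) ⟩
  suc k * (6 * suc p)        ≤⟨ *-mono-≤ (1+m≤2*m (m≥n⇒m/n>0 6[1+p]≤n)) (*-monoʳ-≤ 6 (1+m≤2*m 1≤p)) ⟩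
  2 * k * (6 * (2 * p))      ≡⟨ 2k*[6*2p]≡24*[p*k] k p ⟩
  24 * (p * k)               ∎)
  where
  open ≤-Reasoning
  k : ℕ
  k = n / (6 * suc p)
  2k*[6*2p]≡24*[p*k] : ∀ k p → 2 * k * (6 * (2 * p)) ≡ 24 * (p * k)
  2k*[6*2p]≡24*[p*k] = solve-∀

n*n≤[n/6[1+D/n]]*[24*D] : ∀ n D .{{_ : NonZero n}} → n ≤ D → 12 * D ≤ n * n →
  n * n ≤ n / (6 * suc (D / n)) * (24 * D)
n*n≤[n/6[1+D/n]]*[24*D] n D n≤D 12D≤n*n = begin
  n * n                  ≤⟨ *-monoˡ-≤ n (n≤24*[p*[n/6[1+p]]] n p 1≤p 6[1+p]≤n) ⟩
  24 * (p * k) * n       ≡⟨ rearrange p k n ⟩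
  k * (24 * (p * n))     ≤⟨ *-monoʳ-≤ k (*-monoʳ-≤ 24 (m/n*n≤m D n)) ⟩
  k * (24 * D)           ∎
  where
  open ≤-Reasoning
  p k : ℕ
  p = D / n
  k = n / (6 * suc p)
  1≤p : 1 ≤ p
  1≤p = m≥n⇒m/n>0 n≤D
  12p≤n : 12 * p ≤ n
  12p≤n = *-cancelʳ-≤ (12 * p) n n (begin
    12 * p * n      ≡⟨ *-assoc 12 p n ⟩
    12 * (p * n)    ≤⟨ *-monoʳ-≤ 12 (m/n*n≤m D n) ⟩
    12 * D          ≤⟨ 12D≤n*n ⟩
    n * n           ∎)
  6[1+p]≤n : 6 * suc p ≤ n
  6[1+p]≤n = ≤-trans (*-monoʳ-≤ 6 (1+m≤2*m 1≤p)) (≤-trans (≤-reflexive (sym (*-assoc 6 2 p))) 12p≤n)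
  rearrange : ∀ p k n → 24 * (p * k) * n ≡ k * (24 * (p * n))
  rearrange = solve-∀

[m*n]^o≡m^o*n^o : ∀ m n o → (m * n) ^ o ≡ m ^ o * n ^ o
[m*n]^o≡m^o*n^o m n zero    = refl
[m*n]^o≡m^o*n^o m n (suc o) =
  trans (cong (m * n *_) ([m*n]^o≡m^o*n^o m n o)) (*-interchange m n (m ^ o) (n ^ o))

proposition1 : (n : ℕ) → (G : Graph n) → 1 ≤ n →
    2 * n ≤ 2 * edges G →
    800 * (2 * edges G) ≤ n * n →
    (2 * edges G) ^ (n * n) ≤ numIndep G ^ (250 * (2 * edges G)) * n ^ (n * n)
proposition1 n@(suc _) G _ 2n≤D 800D≤n*n = begin
  D ^ (n * n)                              ≤⟨ ^-monoˡ-≤ (n * n) (<⇒≤ D<sn) ⟩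
  (s * n) ^ (n * n)                        ≡⟨ [m*n]^o≡m^o*n^o s n (n * n) ⟩
  s ^ (n * n) * n ^ (n * n)                ≤⟨ *-monoˡ-≤ (n ^ (n * n)) (^-monoʳ-≤ s n*n≤k*[250*D]) ⟩
  s ^ (k * (250 * D)) * n ^ (n * n)        ≡⟨ cong (_* n ^ (n * n)) (^-*-assoc s k (250 * D)) ⟨
  (s ^ k) ^ (250 * D) * n ^ (n * n)        ≤⟨ *-monoˡ-≤ (n ^ (n * n)) (^-monoˡ-≤ (250 * D) s^k≤i[G]) ⟩
  numIndep G ^ (250 * D) * n ^ (n * n)     ∎
  where
  open ≤-Reasoning
  D s k : ℕ
  D = 2 * edges G
  s = suc (D / n)
  k = n / (6 * s)
  D<sn : D < s * n
  D<sn = m<[1+m/n]*n D n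
  s^k≤i[G] : s ^ k ≤ numIndep G
  s^k≤i[G] = [1+p]^[n/6[1+p]]≤numIndep G (D / n) D<sn
  n*n≤k*[250*D] : n * n ≤ k * (250 * D)
  n*n≤k*[250*D] = begin
    n * n          ≤⟨ n*n≤[n/6[1+D/n]]*[24*D] n D (≤-trans (m≤n*m n 2) 2n≤D)
                                                   (≤-trans (*-monoˡ-≤ D (≤ᵇ⇒≤ 12 800 _)) 800D≤n*n) ⟩
    k * (24 * D)   ≤⟨ *-monoʳ-≤ k (*-monoˡ-≤ D (≤ᵇ⇒≤ 24 250 _)) ⟩
    k * (250 * D)  ∎
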